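{- For every integer $h\geqslant 1$ and $w\geqslant 2$, $\mathrm{SUM2}(\mathcal{H}_{h,w})\leqslant w\,\overline h\log_2\overline h$, where $\overline h=2^{\lceil\log_2 h\rceil}$.
   Context: An image of height $h$ and width $w\geqslant 2$ consists of pixels $p_{ij}$, $i=0,\dots,h-1$ (row, counted from the bottom), $j=0,\dots,w-1$ (column). For a set $T$ of pixels containing exactly one pixel in each of its rows, let $j_{top}$, $j_{bot}$ be the column indices of its pixel in its highest and lowest row, and $\Delta(T)=(j_{top}-j_{bot})\bmod w$. Let $\mathit{tran}_{a,b}(T)=\{p_{i+a,\,(j+b)\bmod w}\mid p_{ij}\in T\}$. Define $\mathcal{H}_0=\{\{p_{00}\},\dots,\{p_{0,w-1}\}\}$ and $\mathcal{H}_k=\{T\cup\mathit{tran}_{2^{k-1},\,\Delta(T)+s}(T)\mid T\in\mathcal{H}_{k-1},\ s\in\{0,1\}\}$ for $k\geqslant 1$. For $h=2^d$, $\mathcal{H}_{h,w}=\mathcal{H}_d$ (the FHT patterns on the $h\times w$ image). For arbitrary $h\geqslant 1$, with $I$ the image of height $h$ and width $w$ (the bottom $h$ rows of the height-$\overline h$ image), $\mathcal{H}_{h,w}=\{T\cap I\mid T\in\mathcal{H}_{\overline h,w}\}$. Pixel values are in $\mathbb{N}=\{0,1,2,\dots\}$ with operation $+$. For a nonempty set $\mathcal{T}=\{T_1,\dots,T_m\}$ of distinct nonempty pixel sets on an image, a fanin-2 circuit is a directed acyclic graph with one input node per pixel (fanin zero) and $m$ output nodes $y_1,\dots,y_m$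 (fanout zero) in which every node has fanin at most $2$; every node of positive fanin (gate) computes the sum of its in-neighbours' values; the circuit computes $\mathcal{T}$ if for all pixel values $y_k=\sum_{p\in T_k}p$ for all $k$. $\mathrm{SUM2}(\mathcal{T})$ is the minimal number of gates of such a circuit. -}

module Defs where

open import Data.Nat using (ℕ; zero; suc; _+_; _*_; _∸_; _^_; _<_)
open import Data.Nat.DivMod using (_%_)
open import Data.Nat.Logarithm using (⌈log₂_⌉)
open import Data.Nat.Properties using (_≟_)
open import Data.List using (List; []; _∷_; [_]; _++_; map; concatMap; upTo; take; deduplicate; length; zip; lookup)
open import Data.Nat.ListAction using (sum)
open import Data.List.Properties using (≡-dec)
open import Data.Fin using (Fin)
open import Data.Product using (_×_; _,_)
open import Data.Unit using (⊤)
open import Relation.Binary.PropositionalEquality using (_≡_; _≢_)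
open import Relation.Nullary using (¬_)
open import Function.Definitions using (Injective)

-- A pixel set containing exactly one pixel in each of the rows 0..n-1
-- (rows counted from the bottom) is encoded by the list of its column
-- indices [c₀, …, c_{n-1}] : the set is { p_{i,cᵢ} | i < n }.
-- All column indices are kept in {0,…,w-1}.

-- j mod w (w ≥ 2 in all uses; for w = 0 we return j, irrelevant)
_modw_ : ℕ → ℕ → ℕ
j modw zero    = j
j modw (suc n) = j % suc n

headD : List ℕ → ℕ
headD []      = 0
headD (x ∷ _) = x

lastD : List ℕ → ℕ
lastD []           = 0
lastD (x ∷ [])     = x
lastD (_ ∷ y ∷ ys) = lastD (y ∷ ys)

-- Δ(T) = (j_top − j_bot) mod w ; j_bot is the column in the lowest row,
-- j_top the column in the highest row.
Δ : ℕ → List ℕ → ℕ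
Δ w T = (lastD T + (w ∸ headD T)) modw w

-- tran_{a,b}(T) for T occupying rows 0..a-1 : the shifted copy occupies rows
-- a..2a-1, with columns (j + b) mod w; appending the shifted column list after
-- T gives the union T ∪ tran_{a,b}(T).
shiftCols : ℕ → ℕ → List ℕ → List ℕ
shiftCols w b T = map (λ j → (j + b) modw w) T

ℋ : ℕ → ℕ → List (List ℕ)
ℋ w zero    = map [_] (upTo w)
ℋ w (suc k) = concatMap (λ T → map (λ s → T ++ shiftCols w (Δ w T + s) T) (0 ∷ 1 ∷ [])) (ℋ w k)

hbar : ℕ → ℕ
hbar h = 2 ^ ⌈log₂ h ⌉

-- ℋ_{h,w} = { T ∩ I | T ∈ ℋ_{h̄,w} } (T ∩ I keeps the bottom h rows),
-- as a duplicate-free list of (encoded) pixel sets.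
FHT : ℕ → ℕ → List (List ℕ)
FHT h w = deduplicate (≡-dec _≟_) (map (take h) (ℋ w ⌈log₂ h ⌉))

-- Nodes are numbered: input node of pixel p_{ij} is i * w + j (i < h, j < w),
-- so nodes 0 .. h*w-1 are the inputs; the k-th gate (k = 0,1,…) in the gate
-- list is node h*w + k.  Gates are listed in topological order.

data Gate : Set where
  gate1 : ℕ → Gate
  gate2 : ℕ → ℕ → Gate

GateOK : ℕ → Gate → Set
GateOK n (gate1 u)   = u < n
GateOK n (gate2 u v) = u < n × v < n × u ≢ v

WellFormed : ℕ → List Gate → Set
WellFormed n []       = ⊤
WellFormed n (g ∷ gs) = GateOK n g × WellFormed (suc n) gs

Reads : Gate → ℕ → Set
Reads (gate1 u)   v = u ≡ v
Reads (gate2 u v) x = (u ≡ x) Data.Sum.⊎ (v ≡ x)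
  where import Data.Sum

NoGateReads : ℕ → List Gate → Set
NoGateReads v []       = ⊤
NoGateReads v (g ∷ gs) = ¬ Reads g v × NoGateReads v gs

nth : List ℕ → ℕ → ℕ
nth []       _       = 0
nth (x ∷ _)  zero    = x
nth (_ ∷ xs) (suc n) = nth xs n

gateValue : List ℕ → Gate → ℕ
gateValue vs (gate1 u)   = nth vs u
gateValue vs (gate2 u v) = nth vs u + nth vs v

evalGates : List ℕ → List Gate → List ℕ
evalGates vs []       = vs
evalGates vs (g ∷ gs) = evalGates (vs ++ [ gateValue vs g ]) gs

inputValues : ℕ → ℕ → (ℕ → ℕ → ℕ) → List ℕ
inputValues h w x = concatMap (λ i → map (λ j → x i j) (upTo w)) (upTo h)

nodeValue : ℕ → ℕ → List Gate → (ℕ → ℕ → ℕ) → ℕ → ℕ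
nodeValue h w gs x v = nth (evalGates (inputValues h w x) gs) v

patternSum : (ℕ → ℕ → ℕ) → List ℕ → ℕ
patternSum x T = sum (map (λ { (i , j) → x i j }) (zip (upTo (length T)) T))

record Computes (h w : ℕ) (𝒯 : List (List ℕ)) (gs : List Gate) : Set where
  field
    wf          : WellFormed (h * w) gs
    out         : Fin (length 𝒯) → ℕ
    out-node    : ∀ k → out k < h * w + length gs
    out-inj     : Injective _≡_ _≡_ out
    out-fanout0 : ∀ k → NoGateReads (out k) gs
    correct     : ∀ (x : ℕ → ℕ → ℕ) k → nodeValue h w gs x (out k) ≡ patternSum x (lookup 𝒯 k)

SUM2≤ : ℕ → ℕ → List (List ℕ) → ℕ → Set
SUM2≤ h w 𝒯 B = Data.Product.∃ λ gs → Computes h w 𝒯 gs × Data.Nat._≤_ (length gs) B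
  where import Data.Product
        import Data.Nat

-- A pattern of ℋ_k is determined by its bottom column c < w and its k binary
-- shift choices, read as an index r < 2^k; we write it pat k c r.  The upper
-- half of pat (k+1) c r is a shift of the lower half pat k c ⌊r/2⌋, hence
-- (Δ being shift-invariant) is itself pat k c′ ⌊r/2⌋ for some column c′.
-- The circuit has a node (k, b, c, r) holding the sum of pat k c r placed on
-- block b (rows b·2^k, …), cut off at row h: level 0 are the input pixels, and
-- node (k+1, b, c, r) is one gate adding the level-k nodes of blocks 2b and
-- 2b+1.  Each of the d levels has 2^(d−k−1) · w · 2^(k+1) = w·2^d gates; the
-- outputs are the nodes (d, 0, c, r).
module Submission where

open import Defs
open import Data.Nat
open import Data.Nat.Properties
open import Data.Nat.DivMod
open import Data.Empty using (⊥)
open import Data.Unit using (⊤; tt)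
open import Data.Product using (Σ; _×_; _,_; proj₁; proj₂)
open import Data.Sum using (inj₁; inj₂)
open import Data.List using (List; []; _∷_; [_]; _++_; map; length; take; zip; applyUpTo; upTo; concatMap; lookup)
open import Data.List.Properties using (map-++; length-++; length-map; length-applyUpTo; ≡-dec)
open import Data.List.Membership.Propositional using (_∈_; find)
open import Data.List.Membership.Propositional.Properties using (∈-map⁻; ∈-concatMap⁻; ∈-upTo⁻; ∈-lookup; ∈-deduplicate⁻)
open import Data.List.Relation.Unary.Any using (here; there)
open import Data.Nat.ListAction using (sum)
open import Relation.Binary.PropositionalEquality hiding ([_])
open import Relation.Nullary using (¬_; Dec; yes; no; contradiction)
open import Data.Nat.Logarithm using (⌈log₂_⌉; ⌈log₂2^n⌉≡n)
open import Data.Nat.Logarithm.Core using (⌈log2⌉)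
open import Data.Fin using (Fin; zero; suc)
import Data.List.Relation.Unary.All as All
open import Data.List.Relation.Unary.Unique.Propositional using (Unique; []; _∷_)
open import Data.List.Relation.Unary.Unique.DecPropositional.Properties (≡-dec _≟_) using (deduplicate-!)
open import Induction.WellFounded using (Acc; acc)
open import Data.Nat.Induction using (<-wellFounded)
open import Data.Nat.Tactic.RingSolver using (solve-∀)

module ModularArithmetic (n : ℕ) .{{_ : NonZero n}} where

  %-absorbˡ : ∀ a b → (a % n + b) % n ≡ (a + b) % n
  %-absorbˡ a b = begin
    (a % n + b) % n         ≡⟨ %-distribˡ-+ (a % n) b n ⟩
    (a % n % n + b % n) % n ≡⟨ cong (λ z → (z + b % n) % n) (m%n%n≡m%n a n) ⟩
    (a % n + b % n) % n     ≡⟨ %-distribˡ-+ a b n ⟨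
    (a + b) % n             ∎
    where open ≡-Reasoning

  %-absorbʳ : ∀ a b → (a + b % n) % n ≡ (a + b) % n
  %-absorbʳ a b = begin
    (a + b % n) % n ≡⟨ cong (_% n) (+-comm a (b % n)) ⟩
    (b % n + a) % n ≡⟨ %-absorbˡ b a ⟩
    (b + a) % n     ≡⟨ cong (_% n) (+-comm b a) ⟩
    (a + b) % n     ∎
    where open ≡-Reasoning

  %-shift-comm : ∀ a b c → ((a + b) % n + c) % n ≡ ((a + c) % n + b) % n
  %-shift-comm a b c = begin
    ((a + b) % n + c) % n ≡⟨ %-absorbˡ (a + b) c ⟩
    (a + b + c) % n       ≡⟨ cong (_% n) (+-assoc a b c) ⟩
    (a + (b + c)) % n     ≡⟨ cong (λ z → (a + z) % n) (+-comm b c) ⟩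
    (a + (c + b)) % n     ≡⟨ cong (_% n) (+-assoc a c b) ⟨
    (a + c + b) % n       ≡⟨ %-absorbˡ (a + c) b ⟨
    ((a + c) % n + b) % n ∎
    where open ≡-Reasoning

  unshift : ∀ a y → (a + y + (n ∸ y % n)) % n ≡ a % n
  unshift a y = begin
    (a + y + c) % n           ≡⟨ %-absorbˡ (a + y) c ⟨
    ((a + y) % n + c) % n     ≡⟨ cong (λ z → (z + c) % n) (%-absorbʳ a y) ⟨
    ((a + y % n) % n + c) % n ≡⟨ %-absorbˡ (a + y % n) c ⟩
    (a + y % n + c) % n       ≡⟨ cong (_% n) (+-assoc a (y % n) c) ⟩
    (a + (y % n + c)) % n     ≡⟨ cong (λ z → (a + z) % n) (m+[n∸m]≡n (<⇒≤ (m%n<n y n))) ⟩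
    (a + n) % n               ≡⟨ [m+n]%n≡m%n a n ⟩
    a % n                     ∎
    where open ≡-Reasoning
          c = n ∸ y % n

  +-cancelʳ-% : ∀ a b y → (a + y) % n ≡ (b + y) % n → a % n ≡ b % n
  +-cancelʳ-% a b y eq = begin
    a % n                     ≡⟨ unshift a y ⟨
    (a + y + c) % n           ≡⟨ %-absorbˡ (a + y) c ⟨
    ((a + y) % n + c) % n     ≡⟨ cong (λ z → (z + c) % n) eq ⟩
    ((b + y) % n + c) % n     ≡⟨ %-absorbˡ (b + y) c ⟩
    (b + y + c) % n           ≡⟨ unshift b y ⟩
    b % n                     ∎
    where open ≡-Reasoning
          c = n ∸ y % n

  -- The residue of l − t, for a residue t < n (this is how Δ is computed).
  diff : ℕ → ℕ → ℕ
  diff l t = (l + (n ∸ t)) % n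

  diff-spec : ∀ l t → t < n → (diff l t + t) % n ≡ l % n
  diff-spec l t t<n = begin
    ((l + (n ∸ t)) % n + t) % n ≡⟨ %-absorbˡ (l + (n ∸ t)) t ⟩
    (l + (n ∸ t) + t) % n       ≡⟨ cong (_% n) (+-assoc l (n ∸ t) t) ⟩
    (l + (n ∸ t + t)) % n       ≡⟨ cong (λ z → (l + z) % n) (m∸n+n≡m (<⇒≤ t<n)) ⟩
    (l + n) % n                 ≡⟨ [m+n]%n≡m%n l n ⟩
    l % n                       ∎
    where open ≡-Reasoning

  diff-shift : ∀ l t a → t < n → diff ((l + a) % n) ((t + a) % n) ≡ diff l t
  diff-shift l t a t<n = begin
    diff l′ t′         ≡⟨ m<n⇒m%n≡m (m%n<n (l′ + (n ∸ t′)) n) ⟨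
    diff l′ t′ % n     ≡⟨ +-cancelʳ-% (diff l′ t′) (diff l t) (t + a) shifted ⟩
    diff l t % n       ≡⟨ m<n⇒m%n≡m (m%n<n (l + (n ∸ t)) n) ⟩
    diff l t           ∎
    where
    open ≡-Reasoning
    l′ = (l + a) % n
    t′ = (t + a) % n
    shifted : (diff l′ t′ + (t + a)) % n ≡ (diff l t + (t + a)) % n
    shifted = begin
      (diff l′ t′ + (t + a)) % n ≡⟨ %-absorbʳ (diff l′ t′) (t + a) ⟨
      (diff l′ t′ + t′) % n      ≡⟨ diff-spec l′ t′ (m%n<n (t + a) n) ⟩
      l′ % n                     ≡⟨ m%n%n≡m%n (l + a) n ⟩
      (l + a) % n                ≡⟨ %-absorbˡ l a ⟨
      (l % n + a) % n            ≡⟨ cong (λ z → (z + a) % n) (diff-spec l t t<n) ⟨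
      ((diff l t + t) % n + a) % n ≡⟨ %-absorbˡ (diff l t + t) a ⟩
      (diff l t + t + a) % n     ≡⟨ cong (_% n) (+-assoc (diff l t) t a) ⟩
      (diff l t + (t + a)) % n   ∎

NonEmpty : List ℕ → Set
NonEmpty []      = ⊥
NonEmpty (_ ∷ _) = ⊤

headD-++ : ∀ xs ys → NonEmpty xs → headD (xs ++ ys) ≡ headD xs
headD-++ (x ∷ xs) ys _ = refl

headD-map : ∀ f xs → NonEmpty xs → headD (map f xs) ≡ f (headD xs)
headD-map f (x ∷ xs) _ = refl

lastD-map : ∀ f xs → NonEmpty xs → lastD (map f xs) ≡ f (lastD xs)
lastD-map f (x ∷ [])     _ = refl
lastD-map f (x ∷ y ∷ xs) _ = lastD-map f (y ∷ xs) tt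

lowBit : ℕ → ℕ
lowBit zero          = zero
lowBit (suc zero)    = suc zero
lowBit (suc (suc r)) = lowBit r

lowBit-even : ∀ r → lowBit (r + r) ≡ 0
lowBit-even zero    = refl
lowBit-even (suc r) = trans (cong lowBit (cong suc (+-suc r r))) (lowBit-even r)

lowBit-odd : ∀ r → lowBit (suc (r + r)) ≡ 1
lowBit-odd zero    = refl
lowBit-odd (suc r) = trans (cong lowBit (cong (λ z → suc (suc z)) (+-suc r r))) (lowBit-odd r)

⌊n/2⌋<m : ∀ r m → r < m + m → ⌊ r /2⌋ < m
⌊n/2⌋<m zero          (suc m) _          = s≤s z≤n
⌊n/2⌋<m (suc zero)    (suc m) _          = s≤s z≤n
⌊n/2⌋<m (suc (suc r)) (suc m) (s≤s r<m+m) =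
  s≤s (⌊n/2⌋<m r m (≤-pred (subst (suc (suc r) ≤_) (+-suc m m) r<m+m)))

2^-double : ∀ k → 2 ^ k + 2 ^ k ≡ 2 ^ suc k
2^-double k = cong (2 ^ k +_) (sym (+-identityʳ (2 ^ k)))

odd<2^ : ∀ k r → r < 2 ^ k → suc (r + r) < 2 ^ suc k
odd<2^ k r r< = subst₂ _≤_ (cong suc (+-suc r r)) (2^-double k) (+-mono-≤ r< r<)

⌊n/2⌋<2^ : ∀ k r → r < 2 ^ suc k → ⌊ r /2⌋ < 2 ^ k
⌊n/2⌋<2^ k r r< = ⌊n/2⌋<m r (2 ^ k) (subst (r <_) (sym (2^-double k)) r<)

-- Closed form of the FHT patterns on a width-W image.  The pattern
-- pat k c r occupies rows 0 … 2^k − 1, starts in column c, and its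
-- k binary choices s ∈ {0,1} are the binary digits of r < 2^k.
module Patterns (w1 : ℕ) where
  W : ℕ
  W = suc w1

  open ModularArithmetic W public

  pat : ℕ → ℕ → ℕ → List ℕ
  pat zero    c r = [ c ]
  pat (suc k) c r = P ++ shiftCols W (Δ W P + lowBit r) P
    where P = pat k c ⌊ r /2⌋

  NonEmpty-pat : ∀ k c r → NonEmpty (pat k c r)
  NonEmpty-pat zero    c r = tt
  NonEmpty-pat (suc k) c r with pat k c ⌊ r /2⌋ | NonEmpty-pat k c ⌊ r /2⌋
  ... | _ ∷ _ | _ = tt

  headD-pat : ∀ k c r → headD (pat k c r) ≡ c
  headD-pat zero    c r = refl
  headD-pat (suc k) c r =
    trans (headD-++ (pat k c ⌊ r /2⌋) _ (NonEmpty-pat k c ⌊ r /2⌋)) (headD-pat k c ⌊ r /2⌋)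

  length-pat : ∀ k c r → length (pat k c r) ≡ 2 ^ k
  length-pat zero    c r = refl
  length-pat (suc k) c r = begin
    length (P ++ shiftCols W _ P)   ≡⟨ length-++ P ⟩
    length P + length (map _ P)     ≡⟨ cong (length P +_) (length-map _ P) ⟩
    length P + length P             ≡⟨ cong₂ _+_ (length-pat k c ⌊ r /2⌋) (length-pat k c ⌊ r /2⌋) ⟩
    2 ^ k + 2 ^ k                   ≡⟨ 2^-double k ⟩
    2 ^ suc k                       ∎
    where open ≡-Reasoning
          P = pat k c ⌊ r /2⌋

  Δ-shift : ∀ P a → NonEmpty P → headD P < W → Δ W (shiftCols W a P) ≡ Δ W P
  Δ-shift P a ne hd<W = begin
    diff (lastD (map f P)) (headD (map f P))
      ≡⟨ cong₂ diff (lastD-map f P ne) (headD-map f P ne) ⟩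
    diff ((lastD P + a) % W) ((headD P + a) % W)
      ≡⟨ diff-shift (lastD P) (headD P) a hd<W ⟩
    diff (lastD P) (headD P) ∎
    where open ≡-Reasoning
          f = λ j → (j + a) % W

  shift-pat : ∀ k c r a → c < W → shiftCols W a (pat k c r) ≡ pat k ((c + a) % W) r
  shift-pat zero    c r a c<W = refl
  shift-pat (suc k) c r a c<W = begin
    shiftCols W a (P ++ shiftCols W e P)
      ≡⟨ map-++ _ P _ ⟩
    shiftCols W a P ++ shiftCols W a (shiftCols W e P)
      ≡⟨ cong₂ _++_ P-shifted (cong (shiftCols W a) (shift-pat k c r′ e c<W)) ⟩
    P′ ++ shiftCols W a (pat k ((c + e) % W) r′)
      ≡⟨ cong (P′ ++_) (shift-pat k ((c + e) % W) r′ a (m%n<n (c + e) W)) ⟩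
    P′ ++ pat k (((c + e) % W + a) % W) r′
      ≡⟨ cong (λ z → P′ ++ pat k z r′) (%-shift-comm c e a) ⟩
    P′ ++ pat k ((c′ + e) % W) r′
      ≡⟨ cong (λ z → P′ ++ pat k ((c′ + (z + lowBit r)) % W) r′) (sym same-Δ) ⟩
    P′ ++ pat k ((c′ + e′) % W) r′
      ≡⟨ cong (P′ ++_) (shift-pat k c′ r′ e′ (m%n<n (c + a) W)) ⟨
    P′ ++ shiftCols W e′ P′ ∎
    where
    open ≡-Reasoning
    r′ = ⌊ r /2⌋
    P  = pat k c r′
    e  = Δ W P + lowBit r
    c′ = (c + a) % W
    P′ = pat k c′ r′
    e′ = Δ W P′ + lowBit r
    P-shifted : shiftCols W a P ≡ P′
    P-shifted = shift-pat k c r′ a c<W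
    same-Δ : Δ W P′ ≡ Δ W P
    same-Δ = trans (cong (Δ W) (sym P-shifted))
               (Δ-shift P a (NonEmpty-pat k c r′) (subst (_< W) (sym (headD-pat k c r′)) c<W))

  IsPat : ℕ → List ℕ → Set
  IsPat k T = Σ ℕ λ c → Σ ℕ λ r → c < W × r < 2 ^ k × T ≡ pat k c r

  ℋ-pat : ∀ k T → T ∈ ℋ W k → IsPat k T
  ℋ-pat zero T T∈ with ∈-map⁻ [_] T∈
  ... | c , c∈ , refl = c , 0 , ∈-upTo⁻ c∈ , s≤s z≤n , refl
  ℋ-pat (suc k) T T∈ with find (∈-concatMap⁻ _ {xs = ℋ W k} T∈)
  ... | T₀ , T₀∈ , T∈′ with ℋ-pat k T₀ T₀∈ | ∈-map⁻ (λ s → T₀ ++ shiftCols W (Δ W T₀ + s) T₀) T∈′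
  ... | c , r , c<W , r< , refl | _ , here refl , refl =
        c , r + r , c<W , ≤-trans (n≤1+n _) (odd<2^ k r r<) , cong₂ extend (n≡⌊n+n/2⌋ r) (sym (lowBit-even r))
    where extend = λ u v → pat k c u ++ shiftCols W (Δ W (pat k c u) + v) (pat k c u)
  ... | c , r , c<W , r< , refl | _ , there (here refl) , refl =
        c , suc (r + r) , c<W , odd<2^ k r r< , cong₂ extend (n≡⌈n+n/2⌉ r) (sym (lowBit-odd r))
    where extend = λ u v → pat k c u ++ shiftCols W (Δ W (pat k c u) + v) (pat k c u)

module PixelSums (x : ℕ → ℕ → ℕ) where

  -- Σ_{i < min(n, |T|)} x (o + i) Tᵢ : the list T placed from row o on,
  -- cut off after n rows.
  truncSum : ℕ → ℕ → List ℕ → ℕ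
  truncSum n       o []      = 0
  truncSum zero    o (_ ∷ _) = 0
  truncSum (suc n) o (j ∷ T) = x o j + truncSum n (suc o) T

  fullSum : ℕ → List ℕ → ℕ
  fullSum o []      = 0
  fullSum o (j ∷ T) = x o j + fullSum (suc o) T

  truncSum-none : ∀ o T → truncSum 0 o T ≡ 0
  truncSum-none o []      = refl
  truncSum-none o (_ ∷ _) = refl

  truncSum-++ : ∀ n o P Q → truncSum n o (P ++ Q) ≡ truncSum n o P + truncSum (n ∸ length P) (o + length P) Q
  truncSum-++ n       o []      Q = cong (λ z → truncSum n z Q) (sym (+-identityʳ o))
  truncSum-++ zero    o (j ∷ P) Q = sym (truncSum-none _ Q)
  truncSum-++ (suc n) o (j ∷ P) Q = begin
    x o j + truncSum n (suc o) (P ++ Q)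
      ≡⟨ cong (x o j +_) (truncSum-++ n (suc o) P Q) ⟩
    x o j + (truncSum n (suc o) P + truncSum (n ∸ length P) (suc o + length P) Q)
      ≡⟨ +-assoc (x o j) _ _ ⟨
    x o j + truncSum n (suc o) P + truncSum (n ∸ length P) (suc o + length P) Q
      ≡⟨ cong (λ z → x o j + truncSum n (suc o) P + truncSum (n ∸ length P) z Q) (sym (+-suc o (length P))) ⟩
    x o j + truncSum n (suc o) P + truncSum (n ∸ length P) (o + suc (length P)) Q ∎
    where open ≡-Reasoning

  truncSum-single : ∀ n o j → 0 < n → truncSum n o [ j ] ≡ x o j
  truncSum-single (suc n) o j _ = +-identityʳ (x o j)

  fullSum-take : ∀ n o T → fullSum o (take n T) ≡ truncSum n o T
  fullSum-take zero    o []      = refl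
  fullSum-take zero    o (_ ∷ _) = refl
  fullSum-take (suc n) o []      = refl
  fullSum-take (suc n) o (j ∷ T) = cong (x o j +_) (fullSum-take n (suc o) T)

  fullSum-zip : (F : ℕ × ℕ → ℕ) → (∀ i j → F (i , j) ≡ x i j) →
    ∀ T f o → (∀ i → f i ≡ o + i) → sum (map F (zip (applyUpTo f (length T)) T)) ≡ fullSum o T
  fullSum-zip F F≗x []      f o f≗ = refl
  fullSum-zip F F≗x (j ∷ T) f o f≗ = cong₂ _+_
    (trans (F≗x (f 0) j) (cong (λ z → x z j) (trans (f≗ 0) (+-identityʳ o))))
    (fullSum-zip F F≗x T (λ i → f (suc i)) (suc o) (λ i → trans (f≗ (suc i)) (+-suc o i)))

  patternSum-take : ∀ h T → patternSum x (take h T) ≡ truncSum h 0 T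
  patternSum-take h T = trans (fullSum-zip _ (λ i j → refl) (take h T) (λ i → i) 0 (λ i → refl))
                              (fullSum-take h 0 T)

nth-++ˡ : ∀ xs ys n → n < length xs → nth (xs ++ ys) n ≡ nth xs n
nth-++ˡ (x ∷ xs) ys zero    _        = refl
nth-++ˡ (x ∷ xs) ys (suc n) (s≤s lt) = nth-++ˡ xs ys n lt

nth-++ʳ : ∀ xs ys n → nth (xs ++ ys) (length xs + n) ≡ nth ys n
nth-++ʳ []       ys n = refl
nth-++ʳ (x ∷ xs) ys n = nth-++ʳ xs ys n

nth-snoc : ∀ xs (y : ℕ) → nth (xs ++ [ y ]) (length xs) ≡ y
nth-snoc []       y = refl
nth-snoc (x ∷ xs) y = nth-snoc xs y

nth-map-applyUpTo : ∀ (φ f : ℕ → ℕ) n c → c < n → nth (map φ (applyUpTo f n)) c ≡ φ (f c)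
nth-map-applyUpTo φ f (suc n) zero    _        = refl
nth-map-applyUpTo φ f (suc n) (suc c) (s≤s lt) = nth-map-applyUpTo φ (λ i → f (suc i)) n c lt

nth-concatMap : ∀ (g : ℕ → List ℕ) w → (∀ i → length (g i) ≡ w) → ∀ h f b c → b < h → c < w →
  nth (concatMap g (applyUpTo f h)) (b * w + c) ≡ nth (g (f b)) c
nth-concatMap g w len-g (suc h) f zero c _ c<w =
  nth-++ˡ (g (f 0)) _ c (subst (c <_) (sym (len-g (f 0))) c<w)
nth-concatMap g w len-g (suc h) f (suc b) c (s≤s b<h) c<w = begin
  nth (g (f 0) ++ rest) (w + b * w + c)                ≡⟨ cong (nth (g (f 0) ++ rest)) index ⟩
  nth (g (f 0) ++ rest) (length (g (f 0)) + (b * w + c)) ≡⟨ nth-++ʳ (g (f 0)) rest (b * w + c) ⟩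
  nth rest (b * w + c)                                 ≡⟨ nth-concatMap g w len-g h (λ i → f (suc i)) b c b<h c<w ⟩
  nth (g (f (suc b))) c                                ∎
  where open ≡-Reasoning
        rest = concatMap g (applyUpTo (λ i → f (suc i)) h)
        index : w + b * w + c ≡ length (g (f 0)) + (b * w + c)
        index = trans (+-assoc w (b * w) c) (cong (_+ (b * w + c)) (sym (len-g (f 0))))

length-concatMap : ∀ (g : ℕ → List ℕ) w → (∀ i → length (g i) ≡ w) → ∀ n f →
  length (concatMap g (applyUpTo f n)) ≡ n * w
length-concatMap g w len-g zero    f = refl
length-concatMap g w len-g (suc n) f =
  trans (length-++ (g (f 0))) (cong₂ _+_ (len-g (f 0)) (length-concatMap g w len-g n (λ i → f (suc i))))

digits-injective : ∀ R a a′ s s′ → s < R → s′ < R → a * R + s ≡ a′ * R + s′ → a ≡ a′ × s ≡ s′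
digits-injective R zero    zero     s s′ _   _    eq = refl , eq
digits-injective R zero    (suc a′) s s′ s<R _    eq =
  contradiction (subst (R ≤_) (sym eq) (≤-trans (m≤m+n R (a′ * R)) (m≤m+n _ s′))) (<⇒≱ s<R)
digits-injective R (suc a) zero     s s′ _   s′<R eq =
  contradiction (subst (R ≤_) eq (≤-trans (m≤m+n R (a * R)) (m≤m+n _ s))) (<⇒≱ s′<R)
digits-injective R (suc a) (suc a′) s s′ s<R s′<R eq
  with digits-injective R a a′ s s′ s<R s′<R
         (+-cancelˡ-≡ R _ _ (trans (sym (+-assoc R (a * R) s)) (trans eq (+-assoc R (a′ * R) s′))))
... | refl , s≡s′ = refl , s≡s′

2^-split : ∀ d k → k ≤ d → 2 ^ (d ∸ k) * 2 ^ k ≡ 2 ^ d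
2^-split d k k≤d = trans (sym (^-distribˡ-+-* 2 (d ∸ k) k)) (cong (2 ^_) (m∸n+n≡m k≤d))

block-fits : ∀ d k b → k ≤ d → b * 2 ^ k < 2 ^ d → suc b * 2 ^ k ≤ 2 ^ d
block-fits d k b k≤d lt = subst (suc b * 2 ^ k ≤_) (2^-split d k k≤d) (*-monoˡ-≤ (2 ^ k) b<)
  where b< : b < 2 ^ (d ∸ k)
        b< = *-cancelʳ-< (2 ^ k) b (2 ^ (d ∸ k)) (subst (b * 2 ^ k <_) (sym (2^-split d k k≤d)) lt)

offset< : ∀ W K D b c r → c < W → r < K → suc b * K ≤ D → (b * W + c) * K + r < W * D
offset< W K D b c r c<W r<K bK≤D = begin-strict
  (b * W + c) * K + r <⟨ +-monoʳ-< ((b * W + c) * K) r<K ⟩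
  (b * W + c) * K + K ≡⟨ +-comm ((b * W + c) * K) K ⟩
  suc (b * W + c) * K ≤⟨ *-monoˡ-≤ K (subst (_≤ suc b * W) (+-suc (b * W) c) bWc<) ⟩
  suc b * W * K       ≡⟨ rearrange (suc b) W K ⟩
  W * (suc b * K)     ≤⟨ *-monoʳ-≤ W bK≤D ⟩
  W * D               ∎
  where
  open ≤-Reasoning
  bWc< : b * W + suc c ≤ W + b * W
  bWc< = subst (b * W + suc c ≤_) (+-comm (b * W) W) (+-monoʳ-≤ (b * W) c<W)
  rearrange : ∀ a W K → a * W * K ≡ W * (a * K)
  rearrange = solve-∀

-- h ≤ h̄ = 2 ^ ⌈log₂ h⌉ (stated for the accessibility-indexed ⌈log2⌉).
≤2^⌈log2⌉ : ∀ n (a : Acc _<_ n) → n ≤ 2 ^ ⌈log2⌉ n a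
≤2^⌈log2⌉ zero          _        = z≤n
≤2^⌈log2⌉ (suc zero)    _        = s≤s z≤n
≤2^⌈log2⌉ (suc (suc m)) (acc rs) = begin
  suc (suc m)               ≤⟨ s≤s (s≤s m≤) ⟩
  suc (suc (⌈ m /2⌉ + ⌈ m /2⌉)) ≡⟨ cong suc (+-suc ⌈ m /2⌉ ⌈ m /2⌉) ⟨
  half + half               ≤⟨ +-mono-≤ IH IH ⟩
  P + P                     ≡⟨ cong (P +_) (+-identityʳ P) ⟨
  2 ^ ⌈log2⌉ (suc (suc m)) (acc rs) ∎
  where
  open ≤-Reasoning
  half = suc ⌈ m /2⌉
  P = 2 ^ ⌈log2⌉ half (rs (⌈n/2⌉<n m))
  IH : half ≤ P
  IH = ≤2^⌈log2⌉ half (rs (⌈n/2⌉<n m))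
  m≤ : m ≤ ⌈ m /2⌉ + ⌈ m /2⌉
  m≤ = subst (_≤ ⌈ m /2⌉ + ⌈ m /2⌉) (⌊n/2⌋+⌈n/2⌉≡n m) (+-monoˡ-≤ ⌈ m /2⌉ (⌊n/2⌋≤⌈n/2⌉ m))

h≤hbar : ∀ h → h ≤ hbar h
h≤hbar h = ≤2^⌈log2⌉ h (<-wellFounded h)

AllAt : (ℕ → Gate → Set) → ℕ → List Gate → Set
AllAt P p []       = ⊤
AllAt P p (g ∷ gs) = P p g × AllAt P (suc p) gs

AllAt-map : ∀ {P Q : ℕ → Gate → Set} → (∀ {p g} → P p g → Q p g) → ∀ p gs → AllAt P p gs → AllAt Q p gs
AllAt-map f p []       _        = tt
AllAt-map f p (g ∷ gs) (Pg , P*) = f Pg , AllAt-map f (suc p) gs P*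

AllAt-++ : ∀ {P} p xs ys → AllAt P p xs → AllAt P (p + length xs) ys → AllAt P p (xs ++ ys)
AllAt-++ {P} p [] ys _ P-ys = subst (λ z → AllAt P z ys) (+-identityʳ p) P-ys
AllAt-++ {P} p (g ∷ xs) ys (Pg , P-xs) P-ys =
  Pg , AllAt-++ (suc p) xs ys P-xs (subst (λ z → AllAt P z ys) (+-suc p (length xs)) P-ys)

AllAt⇒WellFormed : ∀ p gs → AllAt GateOK p gs → WellFormed p gs
AllAt⇒WellFormed p []       _          = tt
AllAt⇒WellFormed p (g ∷ gs) (ok , oks) = ok , AllAt⇒WellFormed (suc p) gs oks

AllAt⇒NoGateReads : ∀ v p gs → AllAt (λ _ g → ¬ Reads g v) p gs → NoGateReads v gs
AllAt⇒NoGateReads v p []       _        = tt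
AllAt⇒NoGateReads v p (g ∷ gs) (¬r , ¬rs) = ¬r , AllAt⇒NoGateReads v (suc p) gs ¬rs

Extends : (List ℕ → Set) → ℕ → Gate → Set
Extends Inv p g = ∀ vs → length vs ≡ p → Inv vs → Inv (vs ++ [ gateValue vs g ])

length-snoc : ∀ (vs : List ℕ) v → length (vs ++ [ v ]) ≡ suc (length vs)
length-snoc vs v = trans (length-++ vs) (+-comm (length vs) 1)

evalGates-invariant : ∀ Inv p gs → AllAt (Extends Inv) p gs →
  ∀ vs → length vs ≡ p → Inv vs → Inv (evalGates vs gs)
evalGates-invariant Inv p []       _          vs _   inv = inv
evalGates-invariant Inv p (g ∷ gs) (ext , exts) vs len inv =
  evalGates-invariant Inv (suc p) gs exts (vs ++ [ gateValue vs g ])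
    (trans (length-snoc vs _) (cong suc len)) (ext vs len inv)

length-evalGates : ∀ vs gs → length (evalGates vs gs) ≡ length vs + length gs
length-evalGates vs []       = sym (+-identityʳ _)
length-evalGates vs (g ∷ gs) = begin
  length (evalGates (vs ++ [ gateValue vs g ]) gs) ≡⟨ length-evalGates (vs ++ [ gateValue vs g ]) gs ⟩
  length (vs ++ [ gateValue vs g ]) + length gs    ≡⟨ cong (_+ length gs) (length-snoc vs _) ⟩
  suc (length vs) + length gs                       ≡⟨ +-suc (length vs) (length gs) ⟨
  length vs + suc (length gs)                       ∎
  where open ≡-Reasoning

concatUpTo : ℕ → (ℕ → List Gate) → List Gate
concatUpTo zero    f = []
concatUpTo (suc n) f = concatUpTo n f ++ f n

length-concatUpTo : ∀ n f R → (∀ i → i < n → length (f i) ≡ R) → length (concatUpTo n f) ≡ n * R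
length-concatUpTo zero    f R _     = refl
length-concatUpTo (suc n) f R len-f = begin
  length (concatUpTo n f ++ f n)         ≡⟨ length-++ (concatUpTo n f) ⟩
  length (concatUpTo n f) + length (f n) ≡⟨ cong₂ _+_ (length-concatUpTo n f R (λ i i<n → len-f i (m<n⇒m<1+n i<n))) (len-f n ≤-refl) ⟩
  n * R + R                              ≡⟨ +-comm (n * R) R ⟩
  suc n * R                              ∎
  where open ≡-Reasoning

AllAt-concatUpTo : ∀ {P} n f R p → (∀ i → i < n → length (f i) ≡ R) →
  (∀ i → i < n → AllAt P (p + i * R) (f i)) → AllAt P p (concatUpTo n f)
AllAt-concatUpTo zero    f R p _     _   = tt
AllAt-concatUpTo {P} (suc n) f R p len-f P-f =
  AllAt-++ p (concatUpTo n f) (f n) (AllAt-concatUpTo n f R p len-f′ P-f′)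
    (subst (λ z → AllAt P (p + z) (f n)) (sym (length-concatUpTo n f R len-f′)) (P-f n ≤-refl))
  where len-f′ : ∀ i → i < n → length (f i) ≡ R
        len-f′ i i<n = len-f i (m<n⇒m<1+n i<n)
        P-f′ : ∀ i → i < n → AllAt P (p + i * R) (f i)
        P-f′ i i<n = P-f i (m<n⇒m<1+n i<n)

length-inputValues : ∀ h w x → length (inputValues h w x) ≡ h * w
length-inputValues h w x = length-concatMap _ w (λ i → trans (length-map _ (upTo w)) (length-applyUpTo (λ j → j) w)) h (λ i → i)

nth-inputValues : ∀ h w x b c → b < h → c < w → nth (inputValues h w x) (b * w + c) ≡ x b c
nth-inputValues h w x b c b<h c<w =
  trans (nth-concatMap _ w (λ i → trans (length-map _ (upTo w)) (length-applyUpTo (λ j → j) w)) h (λ i → i) b c b<h c<w)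
        (nth-map-applyUpTo (x b) (λ j → j) w c c<w)

-- Node (k, b, c, r) — level k ≤ d, block b, start column c < W, index
-- r < 2^k — holds the sum of pat k c r placed on the rows b·2^k, b·2^k + 1, …
-- of block b, cut off at row h.
module Construction (w1 h d : ℕ) (h≤2^d : h ≤ 2 ^ d) (1≤h : 1 ≤ h) where
  open Patterns w1

  -- N inputs, then d levels of L gates each
  N L : ℕ
  N = h * W
  L = W * 2 ^ d

  node : ℕ → ℕ → ℕ → ℕ → ℕ
  node zero    b c r = b * W + c
  node (suc k) b c r = N + (k * L + ((b * W + c) * 2 ^ suc k + r))

  -- labels that are numbered consistently, and those whose block meets the image
  record InRange (k b c r : ℕ) : Set where
    constructor inRange
    field
      level≤  : k ≤ d
      column< : c < W
      index<  : r < 2 ^ k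
      block<  : b * 2 ^ k < 2 ^ d

  record Valid (k b c r : ℕ) : Set where
    constructor valid
    field
      level≤  : k ≤ d
      column< : c < W
      index<  : r < 2 ^ k
      block<  : b * 2 ^ k < h

  Valid⇒InRange : ∀ {k b c r} → Valid k b c r → InRange k b c r
  Valid⇒InRange (valid k≤d c<W r< b<h) = inRange k≤d c<W r< (<-≤-trans b<h h≤2^d)

  0<N : 0 < N
  0<N = *-mono-≤ 1≤h (s≤s z≤n)

  input-node< : ∀ b c → b < h → c < W → b * W + c < N
  input-node< b c b<h c<W = begin-strict
    b * W + c <⟨ +-monoʳ-< (b * W) c<W ⟩
    b * W + W ≡⟨ +-comm (b * W) W ⟩
    suc b * W ≤⟨ *-monoˡ-≤ W b<h ⟩
    h * W     ∎
    where open ≤-Reasoning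

  level-offset< : ∀ k b c r → InRange (suc k) b c r → (b * W + c) * 2 ^ suc k + r < L
  level-offset< k b c r (inRange k<d c<W r< b<) =
    offset< W (2 ^ suc k) (2 ^ d) b c r c<W r< (block-fits d (suc k) b k<d b<)

  node< : ∀ k b c r → Valid k b c r → node k b c r < N + k * L
  node< zero    b c r (valid _ c<W _ b<h) =
    subst (b * W + c <_) (sym (+-identityʳ N)) (input-node< b c (subst (_< h) (*-identityʳ b) b<h) c<W)
  node< (suc k) b c r v = +-monoʳ-< N (subst (k * L + offset <_) (+-comm (k * L) L)
                            (+-monoʳ-< (k * L) (level-offset< k b c r (Valid⇒InRange v))))
    where offset = (b * W + c) * 2 ^ suc k + r

  node≥ : ∀ k b c r → N + k * L ≤ node (suc k) b c r
  node≥ k b c r = +-monoʳ-≤ N (m≤m+n (k * L) _)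

  node-injective : ∀ k {b c r b′ c′ r′} → InRange k b c r → InRange k b′ c′ r′ →
    node k b c r ≡ node k b′ c′ r′ → b ≡ b′ × c ≡ c′ × r ≡ r′
  node-injective zero (inRange _ c<W (s≤s z≤n) _) (inRange _ c′<W (s≤s z≤n) _) eq
    with digits-injective W _ _ _ _ c<W c′<W eq
  ... | b≡ , c≡ = b≡ , c≡ , refl
  node-injective (suc k) {b} {c} {r} {b′} {c′} {r′} ir@(inRange _ c<W r< _) ir′@(inRange _ c′<W r′< _) eq
    with digits-injective L k k _ _ (level-offset< k b c r ir) (level-offset< k b′ c′ r′ ir′) (+-cancelˡ-≡ N _ _ eq)
  ... | _ , offset≡ with digits-injective (2 ^ suc k) (b * W + c) (b′ * W + c′) r r′ r< r′< offset≡
  ... | bc≡ , r≡ with digits-injective W b b′ c c′ c<W c′<W bc≡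
  ... | b≡ , c≡ = b≡ , c≡ , r≡

  node-unique : ∀ k′ b′ c′ r′ k b c r → Valid k′ b′ c′ r′ → InRange (suc k) b c r →
    node k′ b′ c′ r′ ≡ node (suc k) b c r → k′ ≡ suc k × b′ ≡ b × c′ ≡ c × r′ ≡ r
  node-unique zero b′ c′ r′ k b c r (valid _ c′<W _ b′<h) _ eq =
    contradiction (subst (N ≤_) (sym eq) (m≤m+n N _))
                  (<⇒≱ (input-node< b′ c′ (subst (_< h) (*-identityʳ b′) b′<h) c′<W))
  node-unique (suc k′) b′ c′ r′ k b c r v ir eq
    with digits-injective L k′ k _ _ (level-offset< k′ b′ c′ r′ (Valid⇒InRange v)) (level-offset< k b c r ir)
           (+-cancelˡ-≡ N _ _ eq)
  ... | refl , _ with node-injective (suc k) (Valid⇒InRange v) ir eq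
  ... | b≡ , c≡ , r≡ = refl , b≡ , c≡ , r≡

  val : (ℕ → ℕ → ℕ) → ℕ → ℕ → ℕ → ℕ → ℕ
  val x k b c r = PixelSums.truncSum x (h ∸ b * 2 ^ k) (b * 2 ^ k) (pat k c r)

  upperColumn : ℕ → ℕ → ℕ → ℕ
  upperColumn k c r = (c + (Δ W (pat k c ⌊ r /2⌋) + lowBit r)) % W

  -- A block of level k + 1 is a lower and an upper block of level k.
  val-split : ∀ x k b c r → c < W →
    val x (suc k) b c r ≡ val x k (b + b) c ⌊ r /2⌋ + val x k (suc (b + b)) (upperColumn k c r) ⌊ r /2⌋
  val-split x k b c r c<W = begin
    truncSum (h ∸ o) o (P ++ shiftCols W e P)
      ≡⟨ truncSum-++ (h ∸ o) o P _ ⟩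
    truncSum (h ∸ o) o P + truncSum (h ∸ o ∸ length P) (o + length P) (shiftCols W e P)
      ≡⟨ cong₂ (λ u v → truncSum (h ∸ o) o P + truncSum (h ∸ o ∸ u) (o + u) v)
               (length-pat k c ⌊ r /2⌋) (shift-pat k c ⌊ r /2⌋ e c<W) ⟩
    truncSum (h ∸ o) o P + truncSum (h ∸ o ∸ K) (o + K) P′
      ≡⟨ cong (λ u → truncSum (h ∸ o) o P + truncSum u (o + K) P′) (∸-+-assoc h o K) ⟩
    truncSum (h ∸ o) o P + truncSum (h ∸ (o + K)) (o + K) P′
      ≡⟨ cong₂ (λ u v → truncSum (h ∸ u) u P + truncSum (h ∸ v) v P′) lower-start upper-start ⟩
    val x k (b + b) c ⌊ r /2⌋ + val x k (suc (b + b)) (upperColumn k c r) ⌊ r /2⌋ ∎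
    where
    open ≡-Reasoning
    open PixelSums x
    K  = 2 ^ k
    o  = b * 2 ^ suc k
    P  = pat k c ⌊ r /2⌋
    P′ = pat k (upperColumn k c r) ⌊ r /2⌋
    e  = Δ W P + lowBit r
    double : ∀ b K → b * (2 * K) ≡ (b + b) * K
    double = solve-∀
    lower-start : o ≡ (b + b) * K
    lower-start = double b K
    upper-start : o + K ≡ suc (b + b) * K
    upper-start = trans (cong (_+ K) lower-start) (+-comm ((b + b) * K) K)

  val-above : ∀ x k b c r → h ≤ b * 2 ^ k → val x k b c r ≡ 0
  val-above x k b c r h≤ =
    trans (cong (λ n → truncSum n (b * 2 ^ k) (pat k c r)) (m≤n⇒m∸n≡0 h≤)) (truncSum-none _ (pat k c r))
    where open PixelSums x

  val-input : ∀ x b c r → b < h → val x 0 b c r ≡ x b c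
  val-input x b c r b<h = begin
    truncSum (h ∸ b * 1) (b * 1) [ c ] ≡⟨ truncSum-single (h ∸ b * 1) (b * 1) c (m<n⇒0<n∸m (subst (_< h) (sym (*-identityʳ b)) b<h)) ⟩
    x (b * 1) c                        ≡⟨ cong (λ z → x z c) (*-identityʳ b) ⟩
    x b c                              ∎
    where open ≡-Reasoning
          open PixelSums x

  -- The gate computing node (k + 1, b, c, r): the sum of the lower and the
  -- upper half; just the lower half if the upper one lies above row h; a
  -- dummy copy of node 0 if the whole block lies above row h.
  lower upper : ℕ → ℕ → ℕ → ℕ → ℕ
  lower k b c r = node k (b + b) c ⌊ r /2⌋
  upper k b c r = node k (suc (b + b)) (upperColumn k c r) ⌊ r /2⌋

  chooseGate : ∀ {P Q : Set} → Dec P → Dec Q → ℕ → ℕ → Gate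
  chooseGate (yes _) (yes _) u v = gate2 u v
  chooseGate (yes _) (no _)  u v = gate1 u
  chooseGate (no _)  _       u v = gate1 0

  gate : ℕ → ℕ → ℕ → ℕ → Gate
  gate k b c r = chooseGate (b * 2 ^ suc k <? h) (suc (b + b) * 2 ^ k <? h) (lower k b c r) (upper k b c r)

  Correct : (ℕ → ℕ → ℕ) → List ℕ → Set
  Correct x vs = ∀ k b c r → Valid k b c r → node k b c r < length vs → nth vs (node k b c r) ≡ val x k b c r

  Correct-snoc : ∀ x vs v → (∀ k b c r → Valid k b c r → node k b c r ≡ length vs → v ≡ val x k b c r) →
    Correct x vs → Correct x (vs ++ [ v ])
  Correct-snoc x vs v new-ok old-ok k b c r label-ok lt
    with m≤n⇒m<n∨m≡n (m<1+n⇒m≤n (subst (node k b c r <_) (length-snoc vs v) lt))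
  ... | inj₁ old = trans (nth-++ˡ vs _ _ old) (old-ok k b c r label-ok old)
  ... | inj₂ new = trans (cong (nth (vs ++ [ v ])) new) (trans (nth-snoc vs v) (new-ok k b c r label-ok new))

  Sound : ℕ → Gate → Set
  Sound p g = GateOK p g × (∀ c r → ¬ Reads g (node d 0 c r)) × (∀ x → Extends (Correct x) p g)

  module GateFacts (k b c r : ℕ) (k<d : suc k ≤ d) (ir : InRange (suc k) b c r) where
    p : ℕ
    p = node (suc k) b c r

    c<W : c < W
    c<W = InRange.column< ir

    ⌊r/2⌋< : ⌊ r /2⌋ < 2 ^ k
    ⌊r/2⌋< = ⌊n/2⌋<2^ k r (InRange.index< ir)

    lower-valid : b * 2 ^ suc k < h → Valid k (b + b) c ⌊ r /2⌋
    lower-valid below-h = valid (<⇒≤ k<d) c<W ⌊r/2⌋< (subst (_< h) (double b (2 ^ k)) below-h)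
      where double : ∀ b K → b * (2 * K) ≡ (b + b) * K
            double = solve-∀

    upper-valid : suc (b + b) * 2 ^ k < h → Valid k (suc (b + b)) (upperColumn k c r) ⌊ r /2⌋
    upper-valid below-h = valid (<⇒≤ k<d) (m%n<n (c + (Δ W (pat k c ⌊ r /2⌋) + lowBit r)) W) ⌊r/2⌋< below-h

    reads-below : ∀ v → Reads (gate k b c r) v → v < N + k * L
    reads-below v rd with b * 2 ^ suc k <? h | suc (b + b) * 2 ^ k <? h
    reads-below v (inj₁ refl) | yes l | yes _ = node< k _ _ _ (lower-valid l)
    reads-below v (inj₂ refl) | yes _ | yes u = node< k _ _ _ (upper-valid u)
    reads-below v refl        | yes l | no _  = node< k _ _ _ (lower-valid l)
    reads-below v refl        | no _  | _     = ≤-trans 0<N (m≤m+n N (k * L))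

    gate-ok : GateOK p (gate k b c r)
    gate-ok with b * 2 ^ suc k <? h | suc (b + b) * 2 ^ k <? h
    ... | yes l | yes u = <-≤-trans (node< k _ _ _ (lower-valid l)) (node≥ k b c r)
                        , <-≤-trans (node< k _ _ _ (upper-valid u)) (node≥ k b c r)
                        , λ eq → m≢1+m+n (b + b) {0}
                                   (trans (proj₁ (node-injective k (Valid⇒InRange (lower-valid l)) (Valid⇒InRange (upper-valid u)) eq))
                                          (cong suc (sym (+-identityʳ (b + b)))))
    ... | yes l | no _  = <-≤-trans (node< k _ _ _ (lower-valid l)) (node≥ k b c r)
    ... | no _  | _     = ≤-trans 0<N (≤-trans (m≤m+n N (k * L)) (node≥ k b c r))

    output-above : ∀ d′ c′ r′ → suc k ≤ d′ → N + k * L ≤ node d′ 0 c′ r′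
    output-above (suc d′) c′ r′ (s≤s k≤d′) = ≤-trans (+-monoʳ-≤ N (*-monoˡ-≤ L k≤d′)) (node≥ d′ 0 c′ r′)

    skips-outputs : ∀ c′ r′ → ¬ Reads (gate k b c r) (node d 0 c′ r′)
    skips-outputs c′ r′ rd = <⇒≱ (reads-below _ rd) (output-above d c′ r′ k<d)

    gate-value : ∀ x vs → length vs ≡ p → Correct x vs → b * 2 ^ suc k < h →
      gateValue vs (gate k b c r) ≡ val x (suc k) b c r
    gate-value x vs len ok below-h with b * 2 ^ suc k <? h | suc (b + b) * 2 ^ k <? h
    ... | yes l | yes u = begin
      nth vs (lower k b c r) + nth vs (upper k b c r)
        ≡⟨ cong₂ _+_ (read (lower-valid l)) (read (upper-valid u)) ⟩
      val x k (b + b) c ⌊ r /2⌋ + val x k (suc (b + b)) (upperColumn k c r) ⌊ r /2⌋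
        ≡⟨ val-split x k b c r c<W ⟨
      val x (suc k) b c r ∎
      where open ≡-Reasoning
            read : ∀ {b′ c′ r′} → Valid k b′ c′ r′ → nth vs (node k b′ c′ r′) ≡ val x k b′ c′ r′
            read v = ok k _ _ _ v (subst (_ <_) (sym len) (<-≤-trans (node< k _ _ _ v) (node≥ k b c r)))
    ... | yes l | no ¬u = begin
      nth vs (lower k b c r)
        ≡⟨ ok k _ _ _ (lower-valid l) (subst (_ <_) (sym len) (<-≤-trans (node< k _ _ _ (lower-valid l)) (node≥ k b c r))) ⟩
      val x k (b + b) c ⌊ r /2⌋
        ≡⟨ +-identityʳ _ ⟨
      val x k (b + b) c ⌊ r /2⌋ + 0
        ≡⟨ cong (val x k (b + b) c ⌊ r /2⌋ +_) (val-above x k (suc (b + b)) (upperColumn k c r) ⌊ r /2⌋ (≮⇒≥ ¬u)) ⟨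
      val x k (b + b) c ⌊ r /2⌋ + val x k (suc (b + b)) (upperColumn k c r) ⌊ r /2⌋
        ≡⟨ val-split x k b c r c<W ⟨
      val x (suc k) b c r ∎
      where open ≡-Reasoning
    ... | no ¬l | _ = contradiction below-h ¬l

    extends : ∀ x → Extends (Correct x) p (gate k b c r)
    extends x vs len ok = Correct-snoc x vs _ new ok
      where
      new : ∀ k′ b′ c′ r′ → Valid k′ b′ c′ r′ → node k′ b′ c′ r′ ≡ length vs → gateValue vs (gate k b c r) ≡ val x k′ b′ c′ r′
      new k′ b′ c′ r′ v eq with node-unique k′ b′ c′ r′ k b c r v ir (trans eq len)
      ... | refl , refl , refl , refl = gate-value x vs len ok (Valid.block< v)

    sound : Sound p (gate k b c r)
    sound = gate-ok , skips-outputs , extends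

  indexGates : ℕ → ℕ → ℕ → List Gate
  indexGates k b c = concatUpTo (2 ^ suc k) (λ r → [ gate k b c r ])

  columnGates : ℕ → ℕ → List Gate
  columnGates k b = concatUpTo W (indexGates k b)

  levelGates : ℕ → List Gate
  levelGates k = concatUpTo (2 ^ (d ∸ suc k)) (columnGates k)

  gates : List Gate
  gates = concatUpTo d levelGates

  length-indexGates : ∀ k b c → length (indexGates k b c) ≡ 2 ^ suc k * 1
  length-indexGates k b c = length-concatUpTo (2 ^ suc k) (λ r → [ gate k b c r ]) 1 (λ _ _ → refl)

  length-columnGates : ∀ k b → length (columnGates k b) ≡ W * (2 ^ suc k * 1)
  length-columnGates k b = length-concatUpTo W (indexGates k b) _ (λ c _ → length-indexGates k b c)

  length-levelGates : ∀ k → suc k ≤ d → length (levelGates k) ≡ L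
  length-levelGates k k<d = begin
    length (levelGates k)                      ≡⟨ length-concatUpTo (2 ^ (d ∸ suc k)) (columnGates k) _ (λ b _ → length-columnGates k b) ⟩
    2 ^ (d ∸ suc k) * (W * (2 ^ suc k * 1))    ≡⟨ rearrange (2 ^ (d ∸ suc k)) W (2 ^ suc k) ⟩
    W * (2 ^ (d ∸ suc k) * 2 ^ suc k)          ≡⟨ cong (W *_) (2^-split d (suc k) k<d) ⟩
    L                                          ∎
    where open ≡-Reasoning
          rearrange : ∀ a W K → a * (W * (K * 1)) ≡ W * (a * K)
          rearrange = solve-∀

  length-gates : length gates ≡ d * L
  length-gates = length-concatUpTo d levelGates L length-levelGates

  -- the gate of label (k, b, c, r) sits exactly at node (k + 1, b, c, r)
  gate-position : ∀ N k L b W c K r → N + k * L + b * (W * (K * 1)) + c * (K * 1) + r * 1 ≡ N + (k * L + ((b * W + c) * K + r))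
  gate-position = solve-∀

  block<2^d : ∀ k b → b < 2 ^ (d ∸ k) → k ≤ d → b * 2 ^ k < 2 ^ d
  block<2^d k b b< k≤d = subst (b * 2 ^ k <_) (2^-split d k k≤d) (*-monoˡ-< (2 ^ k) {{m^n≢0 2 k}} b<)

  gates-sound : AllAt Sound N gates
  gates-sound = AllAt-concatUpTo d levelGates L N length-levelGates λ k k<d →
    AllAt-concatUpTo (2 ^ (d ∸ suc k)) (columnGates k) _ _ (λ b _ → length-columnGates k b) λ b b< →
    AllAt-concatUpTo W (indexGates k b) _ _ (λ c _ → length-indexGates k b c) λ c c<W →
    AllAt-concatUpTo (2 ^ suc k) (λ r → [ gate k b c r ]) 1 _ (λ _ _ → refl) λ r r< →
      subst (λ p → Sound p (gate k b c r)) (sym (gate-position N k L b W c (2 ^ suc k) r))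
        (GateFacts.sound k b c r k<d (inRange k<d c<W r< (block<2^d (suc k) b b< k<d))) , tt

  inputs-correct : ∀ x → Correct x (inputValues h W x)
  inputs-correct x zero b c r (valid _ c<W _ b<h) _ = begin
    nth (inputValues h W x) (b * W + c) ≡⟨ nth-inputValues h W x b c b<h′ c<W ⟩
    x b c                               ≡⟨ val-input x b c r b<h′ ⟨
    val x 0 b c r                       ∎
    where open ≡-Reasoning
          b<h′ = subst (_< h) (*-identityʳ b) b<h
  inputs-correct x (suc k) b c r _ lt =
    contradiction (subst (_≤ node (suc k) b c r) (sym (length-inputValues h W x)) (m≤m+n N _)) (<⇒≱ lt)

  output-valid : ∀ c r → c < W → r < 2 ^ d → Valid d 0 c r
  output-valid c r c<W r< = valid ≤-refl c<W r< 1≤h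

  output< : ∀ c r → c < W → r < 2 ^ d → node d 0 c r < N + length gates
  output< c r c<W r< = subst (node d 0 c r <_) (cong (N +_) (sym length-gates)) (node< d 0 c r (output-valid c r c<W r<))

  output-value : ∀ x c r → c < W → r < 2 ^ d →
    nodeValue h W gates x (node d 0 c r) ≡ PixelSums.truncSum x h 0 (pat d c r)
  output-value x c r c<W r< =
    evalGates-invariant (Correct x) N gates (AllAt-map (λ s → proj₂ (proj₂ s) x) N gates gates-sound)
      (inputValues h W x) (length-inputValues h W x) (inputs-correct x)
      d 0 c r (output-valid c r c<W r<)
      (subst (node d 0 c r <_) (sym evaluated-length) (output< c r c<W r<))
    where evaluated-length : length (evalGates (inputValues h W x) gates) ≡ N + length gates
          evaluated-length = trans (length-evalGates (inputValues h W x) gates)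
                                   (cong (_+ length gates) (length-inputValues h W x))

  outputs-unread : ∀ c r → NoGateReads (node d 0 c r) gates
  outputs-unread c r = AllAt⇒NoGateReads _ N gates (AllAt-map (λ s → proj₁ (proj₂ s) c r) N gates gates-sound)

  gates-wellFormed : WellFormed N gates
  gates-wellFormed = AllAt⇒WellFormed N gates (AllAt-map proj₁ N gates gates-sound)

lookup-injective : ∀ {xs : List (List ℕ)} → Unique xs → ∀ i j → lookup xs i ≡ lookup xs j → i ≡ j
lookup-injective (_ ∷ _)     zero    zero    _  = refl
lookup-injective (px ∷ _)    zero    (suc j) eq = contradiction eq (All.lookup px (∈-lookup j))
lookup-injective (px ∷ _)    (suc i) zero    eq = contradiction (sym eq) (All.lookup px (∈-lookup i))
lookup-injective (_ ∷ uniq) (suc i) (suc j) eq = cong suc (lookup-injective uniq i j eq)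

-- The circuit computes ℋ_{h,W}: each member is the bottom part of some
-- pat d c r, and is read off the output node (d, 0, c, r).
module FHTCircuit (w1 h : ℕ) (1≤h : 1 ≤ h) where
  d : ℕ
  d = ⌈log₂ h ⌉

  open Patterns w1
  open Construction w1 h d (h≤hbar h) 1≤h

  𝒯 : List (List ℕ)
  𝒯 = FHT h W

  record Origin (T : List ℕ) : Set where
    field
      column    : ℕ
      index     : ℕ
      column<   : column < W
      index<    : index < 2 ^ d
      truncates : T ≡ take h (pat d column index)

  origin : ∀ k → Origin (lookup 𝒯 k)
  origin k with ∈-map⁻ (take h) (∈-deduplicate⁻ (≡-dec _≟_) (map (take h) (ℋ W d)) (∈-lookup {xs = 𝒯} k))
  ... | T , T∈ , eq with ℋ-pat d T T∈
  ... | c , r , c<W , r< , refl = record { column = c ; index = r ; column< = c<W ; index< = r< ; truncates = eq }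

  module _ (k : Fin (length 𝒯)) where
    open Origin (origin k) public

  out : Fin (length 𝒯) → ℕ
  out k = node d 0 (column k) (index k)

  out-valid : ∀ k → Valid d 0 (column k) (index k)
  out-valid k = output-valid (column k) (index k) (column< k) (index< k)

  out-injective : ∀ {k k′} → out k ≡ out k′ → k ≡ k′
  out-injective {k} {k′} eq with node-injective d (Valid⇒InRange (out-valid k)) (Valid⇒InRange (out-valid k′)) eq
  ... | _ , c≡ , r≡ = lookup-injective (deduplicate-! (map (take h) (ℋ W d))) k k′ (begin
    lookup 𝒯 k                              ≡⟨ truncates k ⟩
    take h (pat d (column k) (index k))     ≡⟨ cong₂ (λ c r → take h (pat d c r)) c≡ r≡ ⟩
    take h (pat d (column k′) (index k′))   ≡⟨ truncates k′ ⟨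
    lookup 𝒯 k′                             ∎)
    where open ≡-Reasoning

  out-correct : ∀ x k → nodeValue h W gates x (out k) ≡ patternSum x (lookup 𝒯 k)
  out-correct x k = begin
    nodeValue h W gates x (out k)                   ≡⟨ output-value x (column k) (index k) (column< k) (index< k) ⟩
    truncSum h 0 (pat d (column k) (index k))       ≡⟨ patternSum-take h (pat d (column k) (index k)) ⟨
    patternSum x (take h (pat d (column k) (index k))) ≡⟨ cong (patternSum x) (truncates k) ⟨
    patternSum x (lookup 𝒯 k)                       ∎
    where open ≡-Reasoning
          open PixelSums x

  computes : Computes h W 𝒯 gates
  computes = record
    { wf          = gates-wellFormed
    ; out         = out
    ; out-node    = λ k → output< (column k) (index k) (column< k) (index< k)
    ; out-inj     = out-injective
    ; out-fanout0 = λ k → outputs-unread (column k) (index k)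
    ; correct     = out-correct
    }

  gate-count : length gates ≡ W * hbar h * ⌈log₂ hbar h ⌉
  gate-count = begin
    length gates          ≡⟨ length-gates ⟩
    d * (W * 2 ^ d)       ≡⟨ *-comm d (W * 2 ^ d) ⟩
    W * 2 ^ d * d         ≡⟨ cong (W * 2 ^ d *_) (⌈log₂2^n⌉≡n d) ⟨
    W * hbar h * ⌈log₂ hbar h ⌉ ∎
    where open ≡-Reasoning

  fht-circuit : SUM2≤ h W 𝒯 (W * hbar h * ⌈log₂ hbar h ⌉)
  fht-circuit = gates , computes , ≤-reflexive gate-count

-- w ≥ 1 suffices for the construction.
proposition10 : (h w : ℕ) → 1 ≤ h → 2 ≤ w →
    SUM2≤ h w (FHT h w) (w * hbar h * ⌈log₂ hbar h ⌉)
proposition10 h zero     _   ()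
proposition10 h (suc w1) 1≤h _  = FHTCircuit.fht-circuit w1 h 1≤h
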